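{- $\equiv_{CS}^\Delta$ is a congruence for action prefixing: for every $a\in\Sigma$ and all CSP processes $P,Q$, if $P\equiv_{CS}^\Delta Q$ then $(a\to P)\equiv_{CS}^\Delta(a\to Q)$.
   Context: Fix a set $\Sigma$ of communications and an internal action $\tau\notin\Sigma$; $a$ ranges over $\Sigma$ and $\alpha$ over $\Sigma\cup\{\tau\}$. CSP expressions are generated by $P,Q ::= \mathrm{STOP}\mid \mathrm{div}\mid a\to P\mid P\sqcap Q\mid P\,\Box\,Q\mid P\rhd Q\mid P\,\|_A\,Q\mid P\setminus A\mid f(P)\mid P\,\triangle\,Q\mid P\,\Theta_A\,Q\mid X\mid \mu X.P$, with $A\subseteq\Sigma$, $f:\Sigma\to\Sigma$ (extended by $f(\tau)=\tau$), $X$ a process identifier. A CSP process is an expression in which every occurrence of an identifier $X$ lies within a subexpression $\mu X.P$. Transitions $P\xrightarrow{\alpha}P'$ are the least relations such that: $\mathrm{div}\xrightarrow{\tau}\mathrm{div}$; $(a\to P)\xrightarrow{a}P$; $P\sqcap Q\xrightarrow{\tau}P$, $P\sqcap Q\xrightarrow{\tau}Q$; if $P\xrightarrow{a}P'$ then $P\Box Q\xrightarrow{a}P'$, $Q\Box P\xrightarrow{a}P'$, $P\rhd Q\xrightarrow{a}P'$; if $P\xrightarrow{\tau}P'$ then $P\Box Q\xrightarrow{\tau}P'\Box Q$, $Q\Box P\xrightarrow{\tau}Q\Box P'$, $P\rhd Q\xrightarrow{\tau}P'\rhd Q$; $P\rhd Q\xrightarrow{\tau}Q$; if $P\xrightarrow{\alpha}P'$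 then $f(P)\xrightarrow{f(\alpha)}f(P')$; if $P\xrightarrow{\alpha}P'$, $\alpha\notin A$, then $P\|_AQ\xrightarrow{\alpha}P'\|_AQ$, $Q\|_AP\xrightarrow{\alpha}Q\|_AP'$, $P\setminus A\xrightarrow{\alpha}P'\setminus A$, $P\Theta_AQ\xrightarrow{\alpha}P'\Theta_AQ$; if $P\xrightarrow{a}P'$, $Q\xrightarrow{a}Q'$, $a\in A$, then $P\|_AQ\xrightarrow{a}P'\|_AQ'$; if $P\xrightarrow{a}P'$, $a\in A$, then $P\setminus A\xrightarrow{\tau}P'\setminus A$ and $P\Theta_AQ\xrightarrow{a}Q$; if $P\xrightarrow{\alpha}P'$ then $P\triangle Q\xrightarrow{\alpha}P'\triangle Q$; if $Q\xrightarrow{\tau}Q'$ then $P\triangle Q\xrightarrow{\tau}P\triangle Q'$; if $Q\xrightarrow{a}Q'$ then $P\triangle Q\xrightarrow{a}Q'$; $\mu X.P\xrightarrow{\tau}P[\mu X.P/X]$. Write $P\Rightarrow Q$ if $P=P_0\xrightarrow{\tau}\cdots\xrightarrow{\tau}P_n=Q$ ($n\ge 0$); $P\overset{\alpha}{\Rightarrow}Q$ if $P\Rightarrow P'\xrightarrow{\alpha}Q'\Rightarrow Q$; $P\overset{\hat\alpha}{\Rightarrow}Q$ means $P\overset{\alpha}{\Rightarrow}Q$ if $\alpha\in\Sigma$ and $P\Rightarrow Q$ if $\alpha=\tau$. $P{\Uparrow}$ ($P$ diverges) if there are $P_0,P_1,\dots$ with $P\Rightarrow P_0\xrightarrow{\tau}P_1\xrightarrow{\tau}\cdots$.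 A coupled simulation is a relation $\mathcal R$ on CSP processes such that (i) if $P\mathcal RQ$ and $P\xrightarrow{\alpha}P'$ then $Q\overset{\hat\alpha}{\Rightarrow}Q'$ with $P'\mathcal RQ'$ for some $Q'$, and (ii) if $P\mathcal RQ$ then $Q\Rightarrow Q'$ with $Q'\mathcal RP$ for some $Q'$; it is divergence-preserving if $P\mathcal RQ$ and $P{\Uparrow}$ imply $Q{\Uparrow}$. $P\sqsupseteq_{CS}^\Delta Q$ (also written $Q\sqsubseteq_{CS}^\Delta P$) iff $P\mathcal RQ$ for some divergence-preserving coupled simulation $\mathcal R$; $P\equiv_{CS}^\Delta Q$ iff $P\sqsupseteq_{CS}^\Delta Q$ and $Q\sqsupseteq_{CS}^\Delta P$. -}

module Defs where

open import Level using (0ℓ)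
open import Data.Nat using (ℕ; zero; suc; _≟_)
open import Data.Product using (Σ-syntax; _×_; ∃-syntax)
open import Data.Unit using (⊤)
open import Data.Empty using (⊥)
open import Relation.Nullary using (¬_; yes; no)
open import Relation.Unary using (Pred; _∈_)
open import Relation.Binary.PropositionalEquality using (_≡_)

-- Process identifiers X are natural numbers (a countably infinite supply).
Ident : Set
Ident = ℕ

data Proc (Σ : Set) : Set₁ where
  STOP  : Proc Σ
  div   : Proc Σ
  _⟶_   : Σ → Proc Σ → Proc Σ
  _⊓_   : Proc Σ → Proc Σ → Proc Σ
  _□_   : Proc Σ → Proc Σ → Proc Σ
  _▷_   : Proc Σ → Proc Σ → Proc Σ
  par   : Proc Σ → Pred Σ 0ℓ → Proc Σ → Proc Σ
  hide  : Proc Σ → Pred Σ 0ℓ → Proc Σ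
  ren   : (Σ → Σ) → Proc Σ → Proc Σ
  _△_   : Proc Σ → Proc Σ → Proc Σ
  thr   : Proc Σ → Pred Σ 0ℓ → Proc Σ → Proc Σ
  var   : Ident → Proc Σ
  μ     : Ident → Proc Σ → Proc Σ

module _ {Σ : Set} where

  data FreeIn (X : Ident) : Proc Σ → Set₁ where
    f-pre  : ∀ {a P} → FreeIn X P → FreeIn X (a ⟶ P)
    f-⊓ˡ   : ∀ {P Q} → FreeIn X P → FreeIn X (P ⊓ Q)
    f-⊓ʳ   : ∀ {P Q} → FreeIn X Q → FreeIn X (P ⊓ Q)
    f-□ˡ   : ∀ {P Q} → FreeIn X P → FreeIn X (P □ Q)
    f-□ʳ   : ∀ {P Q} → FreeIn X Q → FreeIn X (P □ Q)
    f-▷ˡ   : ∀ {P Q} → FreeIn X P → FreeIn X (P ▷ Q)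
    f-▷ʳ   : ∀ {P Q} → FreeIn X Q → FreeIn X (P ▷ Q)
    f-parˡ : ∀ {P A Q} → FreeIn X P → FreeIn X (par P A Q)
    f-parʳ : ∀ {P A Q} → FreeIn X Q → FreeIn X (par P A Q)
    f-hide : ∀ {P A} → FreeIn X P → FreeIn X (hide P A)
    f-ren  : ∀ {f P} → FreeIn X P → FreeIn X (ren f P)
    f-△ˡ   : ∀ {P Q} → FreeIn X P → FreeIn X (P △ Q)
    f-△ʳ   : ∀ {P Q} → FreeIn X Q → FreeIn X (P △ Q)
    f-thrˡ : ∀ {P A Q} → FreeIn X P → FreeIn X (thr P A Q)
    f-thrʳ : ∀ {P A Q} → FreeIn X Q → FreeIn X (thr P A Q)
    f-var  : FreeIn X (var X)
    f-μ    : ∀ {Y P} → ¬ (X ≡ Y) → FreeIn X P → FreeIn X (μ Y P)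

  -- A CSP process: every identifier occurrence is bound by an enclosing μ.
  Closed : Proc Σ → Set₁
  Closed P = ∀ X → ¬ FreeIn X P

  -- P [ R / X ] : replace free occurrences of X by R
  -- (only ever used with R closed, so no capture can occur).
  _[_/_] : Proc Σ → Proc Σ → Ident → Proc Σ
  STOP [ R / X ] = STOP
  div [ R / X ] = div
  (a ⟶ P) [ R / X ] = a ⟶ (P [ R / X ])
  (P ⊓ Q) [ R / X ] = (P [ R / X ]) ⊓ (Q [ R / X ])
  (P □ Q) [ R / X ] = (P [ R / X ]) □ (Q [ R / X ])
  (P ▷ Q) [ R / X ] = (P [ R / X ]) ▷ (Q [ R / X ])
  par P A Q [ R / X ] = par (P [ R / X ]) A (Q [ R / X ])
  hide P A [ R / X ] = hide (P [ R / X ]) A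
  ren f P [ R / X ] = ren f (P [ R / X ])
  (P △ Q) [ R / X ] = (P [ R / X ]) △ (Q [ R / X ])
  thr P A Q [ R / X ] = thr (P [ R / X ]) A (Q [ R / X ])
  var Y [ R / X ] with Y ≟ X
  ... | yes _ = R
  ... | no  _ = var Y
  μ Y P [ R / X ] with Y ≟ X
  ... | yes _ = μ Y P
  ... | no  _ = μ Y (P [ R / X ])

data Act (Σ : Set) : Set where
  τ  : Act Σ
  ev : Σ → Act Σ

module _ {Σ : Set} where

  mapAct : (Σ → Σ) → Act Σ → Act Σ
  mapAct f τ = τ
  mapAct f (ev a) = ev (f a)

  _∉ᵃ_ : Act Σ → Pred Σ 0ℓ → Set
  τ ∉ᵃ A = ⊤
  ev a ∉ᵃ A = ¬ (a ∈ A)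

  infix 4 _─[_]→_
  data _─[_]→_ : Proc Σ → Act Σ → Proc Σ → Set₁ where
    div-τ  : div ─[ τ ]→ div
    pre    : ∀ {a P} → (a ⟶ P) ─[ ev a ]→ P
    ⊓ˡ     : ∀ {P Q} → (P ⊓ Q) ─[ τ ]→ P
    ⊓ʳ     : ∀ {P Q} → (P ⊓ Q) ─[ τ ]→ Q
    □ˡ-ev  : ∀ {P P' Q a} → P ─[ ev a ]→ P' → (P □ Q) ─[ ev a ]→ P'
    □ʳ-ev  : ∀ {P P' Q a} → P ─[ ev a ]→ P' → (Q □ P) ─[ ev a ]→ P'
    ▷-ev   : ∀ {P P' Q a} → P ─[ ev a ]→ P' → (P ▷ Q) ─[ ev a ]→ P'
    □ˡ-τ   : ∀ {P P' Q} → P ─[ τ ]→ P' → (P □ Q) ─[ τ ]→ (P' □ Q)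
    □ʳ-τ   : ∀ {P P' Q} → P ─[ τ ]→ P' → (Q □ P) ─[ τ ]→ (Q □ P')
    ▷-τ    : ∀ {P P' Q} → P ─[ τ ]→ P' → (P ▷ Q) ─[ τ ]→ (P' ▷ Q)
    ▷-time : ∀ {P Q} → (P ▷ Q) ─[ τ ]→ Q
    ren-st : ∀ {f P P' α} → P ─[ α ]→ P' → ren f P ─[ mapAct f α ]→ ren f P'
    parˡ   : ∀ {P P' Q A α} → P ─[ α ]→ P' → α ∉ᵃ A → par P A Q ─[ α ]→ par P' A Q
    parʳ   : ∀ {P P' Q A α} → P ─[ α ]→ P' → α ∉ᵃ A → par Q A P ─[ α ]→ par Q A P'
    hide-n : ∀ {P P' A α} → P ─[ α ]→ P' → α ∉ᵃ A → hide P A ─[ α ]→ hide P' A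
    thr-n  : ∀ {P P' Q A α} → P ─[ α ]→ P' → α ∉ᵃ A → thr P A Q ─[ α ]→ thr P' A Q
    par-s  : ∀ {P P' Q Q' A a} → P ─[ ev a ]→ P' → Q ─[ ev a ]→ Q' → a ∈ A →
             par P A Q ─[ ev a ]→ par P' A Q'
    hide-h : ∀ {P P' A a} → P ─[ ev a ]→ P' → a ∈ A → hide P A ─[ τ ]→ hide P' A
    thr-t  : ∀ {P P' Q A a} → P ─[ ev a ]→ P' → a ∈ A → thr P A Q ─[ ev a ]→ Q
    △ˡ     : ∀ {P P' Q α} → P ─[ α ]→ P' → (P △ Q) ─[ α ]→ (P' △ Q)
    △ʳ-τ   : ∀ {P Q Q'} → Q ─[ τ ]→ Q' → (P △ Q) ─[ τ ]→ (P △ Q')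
    △ʳ-ev  : ∀ {P Q Q' a} → Q ─[ ev a ]→ Q' → (P △ Q) ─[ ev a ]→ Q'
    unfold : ∀ {X P} → μ X P ─[ τ ]→ (P [ μ X P / X ])

  infix 4 _⇒_
  data _⇒_ : Proc Σ → Proc Σ → Set₁ where
    ⇒-refl : ∀ {P} → P ⇒ P
    ⇒-step : ∀ {P P' Q} → P ─[ τ ]→ P' → P' ⇒ Q → P ⇒ Q

  _=[_]⇒_ : Proc Σ → Act Σ → Proc Σ → Set₁
  P =[ α ]⇒ Q = ∃[ P' ] ∃[ Q' ] (P ⇒ P' × P' ─[ α ]→ Q' × Q' ⇒ Q)

  _=[_^]⇒_ : Proc Σ → Act Σ → Proc Σ → Set₁
  P =[ τ ^]⇒ Q = P ⇒ Q
  P =[ ev a ^]⇒ Q = P =[ ev a ]⇒ Q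

  _⇑ : Proc Σ → Set₁
  P ⇑ = Σ[ g ∈ (ℕ → Proc Σ) ] (P ⇒ g 0 × (∀ n → g n ─[ τ ]→ g (suc n)))

  Rel₁ : Set₂
  Rel₁ = Proc Σ → Proc Σ → Set₁

  OnProcesses : Rel₁ → Set₁
  OnProcesses R = ∀ {P Q} → R P Q → Closed P × Closed Q

  IsCoupledSimulation : Rel₁ → Set₁
  IsCoupledSimulation R =
    (∀ {P Q P' α} → R P Q → P ─[ α ]→ P' → ∃[ Q' ] (Q =[ α ^]⇒ Q' × R P' Q'))
    × (∀ {P Q} → R P Q → ∃[ Q' ] (Q ⇒ Q' × R Q' P))

  DivergencePreserving : Rel₁ → Set₁
  DivergencePreserving R = ∀ {P Q} → R P Q → P ⇑ → Q ⇑

  -- P ⊒ Q  (i.e. Q ⊑^Δ_CS P)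
  _⊒CSΔ_ : Proc Σ → Proc Σ → Set₂
  P ⊒CSΔ Q = Σ[ R ∈ Rel₁ ] (OnProcesses R × IsCoupledSimulation R
                            × DivergencePreserving R × R P Q)

  _≡CSΔ_ : Proc Σ → Proc Σ → Set₂
  P ≡CSΔ Q = (P ⊒CSΔ Q) × (Q ⊒CSΔ P)

-- Relate a → P and a → Q in both directions and add witnesses of P ⊒ Q and
-- Q ⊒ P. Both pairs are needed: clause (ii) for (a → P, a → Q) forces
-- (a → Q, a → P) into the relation, and its a-step must land on a pair Q, P.
-- Prefixes cannot perform τ, so the new pairs never diverge.
module Submission where

open import Defs
open import Data.Empty using (⊥-elim)
open import Data.Product using (_×_; _,_; proj₁; proj₂; ∃-syntax)
open import Function using (_∘_)
open import Relation.Nullary using (¬_)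

module _ {Σ : Set} where

  Closed-⟶ : ∀ {a} {P : Proc Σ} → Closed P → Closed (a ⟶ P)
  Closed-⟶ closed X (f-pre free) = closed X free

  ⟶-=[ev]⇒ : ∀ {a} {P : Proc Σ} → (a ⟶ P) =[ ev a ]⇒ P
  ⟶-=[ev]⇒ {a} {P} = a ⟶ P , P , ⇒-refl , pre , ⇒-refl

  ⟶-⇒-¬τ : ∀ {a} {P T U : Proc Σ} → (a ⟶ P) ⇒ T → ¬ (T ─[ τ ]→ U)
  ⟶-⇒-¬τ ⇒-refl ()
  ⟶-⇒-¬τ (⇒-step () _)

  ¬⟶⇑ : ∀ {a} {P : Proc Σ} → ¬ ((a ⟶ P) ⇑)
  ¬⟶⇑ (g , P⇒g₀ , steps) = ⟶-⇒-¬τ P⇒g₀ (steps 0)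

module PrefixClosure {Σ : Set} (a : Σ) (P Q : Proc Σ) (R S : Rel₁ {Σ}) where

  data Prefixed : Rel₁ {Σ} where
    via-R : ∀ {X Y} → R X Y → Prefixed X Y
    via-S : ∀ {X Y} → S X Y → Prefixed X Y
    ⟶PQ   : Prefixed (a ⟶ P) (a ⟶ Q)
    ⟶QP   : Prefixed (a ⟶ Q) (a ⟶ P)

  module _ (closedP : Closed P) (closedQ : Closed Q)
           (onR : OnProcesses R) (onS : OnProcesses S)
           where

    Prefixed-onProcesses : OnProcesses Prefixed
    Prefixed-onProcesses (via-R r) = onR r
    Prefixed-onProcesses (via-S s) = onS s
    Prefixed-onProcesses ⟶PQ       = Closed-⟶ closedP , Closed-⟶ closedQ
    Prefixed-onProcesses ⟶QP       = Closed-⟶ closedQ , Closed-⟶ closedP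

  module _ (simR : IsCoupledSimulation R) (simS : IsCoupledSimulation S)
           (RPQ : R P Q) (SQP : S Q P)
           where

    Prefixed-simulates : ∀ {X Y X' α} → Prefixed X Y → X ─[ α ]→ X' →
                         ∃[ Y' ] (Y =[ α ^]⇒ Y' × Prefixed X' Y')
    Prefixed-simulates (via-R r) t with proj₁ simR r t
    ... | Y' , Y⇒Y' , r' = Y' , Y⇒Y' , via-R r'
    Prefixed-simulates (via-S s) t with proj₁ simS s t
    ... | Y' , Y⇒Y' , s' = Y' , Y⇒Y' , via-S s'
    Prefixed-simulates ⟶PQ pre = Q , ⟶-=[ev]⇒ , via-R RPQ
    Prefixed-simulates ⟶QP pre = P , ⟶-=[ev]⇒ , via-S SQP

    Prefixed-coupled : ∀ {X Y} → Prefixed X Y → ∃[ Y' ] (Y ⇒ Y' × Prefixed Y' X)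
    Prefixed-coupled (via-R r) with proj₂ simR r
    ... | Y' , Y⇒Y' , r' = Y' , Y⇒Y' , via-R r'
    Prefixed-coupled (via-S s) with proj₂ simS s
    ... | Y' , Y⇒Y' , s' = Y' , Y⇒Y' , via-S s'
    Prefixed-coupled ⟶PQ = a ⟶ Q , ⇒-refl , ⟶QP
    Prefixed-coupled ⟶QP = a ⟶ P , ⇒-refl , ⟶PQ

  module _ (divR : DivergencePreserving R) (divS : DivergencePreserving S) where

    Prefixed-divergencePreserving : DivergencePreserving Prefixed
    Prefixed-divergencePreserving (via-R r) = divR r
    Prefixed-divergencePreserving (via-S s) = divS s
    Prefixed-divergencePreserving ⟶PQ       = ⊥-elim ∘ ¬⟶⇑
    Prefixed-divergencePreserving ⟶QP       = ⊥-elim ∘ ¬⟶⇑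

⟶-mono-⊒CSΔ : {Σ : Set} (a : Σ) {P Q : Proc Σ} → Closed P → Closed Q →
              P ⊒CSΔ Q → Q ⊒CSΔ P → (a ⟶ P) ⊒CSΔ (a ⟶ Q)
⟶-mono-⊒CSΔ a {P} {Q} closedP closedQ
  (R , onR , simR , divR , RPQ) (S , onS , simS , divS , SQP) =
    Prefixed
  , Prefixed-onProcesses closedP closedQ onR onS
  , (Prefixed-simulates simR simS RPQ SQP , Prefixed-coupled simR simS RPQ SQP)
  , Prefixed-divergencePreserving divR divS
  , ⟶PQ
  where open PrefixClosure a P Q R S

proposition4 : {Σ : Set} (a : Σ) (P Q : Proc Σ) → Closed P → Closed Q →
               P ≡CSΔ Q → (a ⟶ P) ≡CSΔ (a ⟶ Q)
proposition4 a P Q closedP closedQ (P⊒Q , Q⊒P) =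
  ⟶-mono-⊒CSΔ a closedP closedQ P⊒Q Q⊒P , ⟶-mono-⊒CSΔ a closedQ closedP Q⊒P P⊒Q
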